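{- Let $q$ be an odd prime power with $q\equiv \pm 2\pmod 5$. Let $\theta,\delta\in\mathbb{F}_{q^6}$ satisfy $\theta^2+\theta=1$ and $\delta^2+\delta=1$, and define $f(x)=x^q+x^{q^3}+\theta x^{q^5}$ and $g(x)=x^q+x^{q^3}+\delta x^{q^5}$ on $\mathbb{F}_{q^6}$. Then the $\mathbb{F}_q$-subspaces $U_f$ and $U_g$ of $\mathbb{F}_{q^6}^2$ are $\Gamma\mathrm{L}(2,q^6)$-equivalent.
   Context: For a $q$-polynomial $h$ over $\mathbb{F}_{q^n}$ (i.e. $h=\sum_i a_iX^{q^i}$ with $a_i\in\mathbb{F}_{q^n}$), $U_h=\{(x,h(x)) : x\in\mathbb{F}_{q^n}\}\subseteq\mathbb{F}_{q^n}^2$, an $\mathbb{F}_q$-subspace. Two such subspaces $U_h,U_k$ are $\Gamma\mathrm{L}(2,q^n)$-equivalent if there exists $\varphi\in\Gamma\mathrm{L}(2,q^n)$ with $U_h^\varphi=U_k$. -}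

module Defs where

open import Level using (Level; _⊔_) renaming (suc to lsuc)
open import Data.Nat using (ℕ; zero; suc; _≤_) renaming (_^_ to _^ℕ_)
open import Data.Nat.Primality using (Prime)
open import Data.Fin using (Fin)
open import Data.Product using (Σ; _×_; ∃; _,_)
open import Relation.Binary.PropositionalEquality using (_≡_)
open import Relation.Nullary using (¬_)
open import Algebra.Bundles using (CommutativeRing)

IsPrimePower : ℕ → Set
IsPrimePower q = Σ ℕ λ p → Σ ℕ λ k → Prime p × 1 ≤ k × q ≡ p ^ℕ k

record Field (c ℓ : Level) : Set (lsuc (c ⊔ ℓ)) where
  field
    commRing : CommutativeRing c ℓ
  open CommutativeRing commRing public
  field
    1≉0     : ¬ (1# ≈ 0#)
    inverse : ∀ x → ¬ (x ≈ 0#) → Σ Carrier λ y → x * y ≈ 1#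

module FieldTheory {c₀ ℓ₀ : Level} (F : Field c₀ ℓ₀) where
  open Field F

  infixr 8 _^_
  _^_ : Carrier → ℕ → Carrier
  x ^ zero = 1#
  x ^ suc n = x * (x ^ n)

  HasSize : ℕ → Set (c₀ ⊔ ℓ₀)
  HasSize N = Σ (Fin N → Carrier) λ e →
                (∀ i j → e i ≈ e j → i ≡ j) × (∀ x → Σ (Fin N) λ i → e i ≈ x)

  record Automorphism : Set (c₀ ⊔ ℓ₀) where
    field
      σ      : Carrier → Carrier
      σ-cong : ∀ {x y} → x ≈ y → σ x ≈ σ y
      σ-+    : ∀ x y → σ (x + y) ≈ σ x + σ y
      σ-*    : ∀ x y → σ (x * y) ≈ σ x * σ y
      σ-1    : σ 1# ≈ 1#
      σ-inj  : ∀ {x y} → σ x ≈ σ y → x ≈ y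
      σ-surj : ∀ y → Σ Carrier λ x → σ x ≈ y

  record ΓL2 : Set (c₀ ⊔ ℓ₀) where
    field
      aut     : Automorphism
      a b c d : Carrier
      det≉0   : ¬ (a * d - b * c ≈ 0#)
    open Automorphism aut
    apply₁ : Carrier → Carrier → Carrier
    apply₁ u v = a * σ u + b * σ v
    apply₂ : Carrier → Carrier → Carrier
    apply₂ u v = c * σ u + d * σ v

  -- U_h^φ = U_k, where U_h = {(x , h x) : x ∈ F}
  MapsOnto : ΓL2 → (Carrier → Carrier) → (Carrier → Carrier) → Set (c₀ ⊔ ℓ₀)
  MapsOnto φ h k =
    (∀ x → Σ Carrier λ y → apply₁ x (h x) ≈ y × apply₂ x (h x) ≈ k y)
    × (∀ y → Σ Carrier λ x → apply₁ x (h x) ≈ y × apply₂ x (h x) ≈ k y)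
    where open ΓL2 φ

  ΓL-Equivalent : (Carrier → Carrier) → (Carrier → Carrier) → Set (c₀ ⊔ ℓ₀)
  ΓL-Equivalent h k = Σ ΓL2 λ φ → MapsOnto φ h k

  fPoly : ℕ → Carrier → Carrier → Carrier
  fPoly q t x = x ^ q + x ^ (q ^ℕ 3) + t * x ^ (q ^ℕ 5)

{-# OPTIONS --safe #-}
module Submission where

-- If θ = δ the identity automorphism works. Otherwise δ = −1 − θ is the other root of
-- X² + X − 1, and we show that the Frobenius x ↦ xᵖ (p the characteristic) maps θ to δ,
-- so that (x , y) ↦ (xᵖ , yᵖ) maps U_f onto U_g. Since θᵖ is again a root, it suffices
-- that θᵖ ≠ θ. Adjoin t with t² − θt + 1 = 0, so that θ = t + t⁻¹ and t⁵ = 1. If θᵖ = θ,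
-- the Frobenius of K[t] makes tᵖ = tʳ (r = p mod 5 ∈ {2, 3}) another root of X² − θX + 1;
-- this forces 5 = 0, hence r = 0 and 1 = 0. Finally p ≡ ±2 (mod 5) because q = pᵏ is,
-- and the squares 0, ±1 modulo 5 are closed under multiplication.

open import Defs
open import Level using (Level)
open import Data.Nat as ℕ
  using (ℕ; zero; suc; _%_; _/_; _!; _∸_; _<_; _≤_; z≤n; s≤s; NonZero) renaming (_^_ to _^ℕ_)
import Data.Nat.Properties as ℕ
open import Data.Nat.Properties using ()
open import Data.Nat.Combinatorics using (_C_; nCk≡n!/k![n-k]!; k![n∸k]!∣n!; nCn≡1)
open import Data.Nat.DivMod using (m/n*n≡m; m≡m%n+[m/n]*n; %-distribˡ-*; m%n<n)
open import Data.Nat.Divisibility using (_∣_; divides; ∣⇒≤; m∣m*n; n∣m*n)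
open import Data.Nat.Primality using (Prime; euclidsLemma)
open import Data.Integer as ℤ using (ℤ; +_; -[1+_]; _⊖_)
import Data.Integer.Properties as ℤ
import Data.Sign as Sign
open import Data.Fin as Fin using (Fin; toℕ; inject₁; fromℕ; punchOut)
import Data.Fin.Properties as Fin
open import Data.Fin.Permutation using (permutation)
open import Data.Maybe using (Maybe; just; nothing)
open import Data.Product as Product using (Σ; _,_; proj₁; proj₂)
open import Data.Sum using (_⊎_; inj₁; inj₂)
open import Data.Vec.Functional using (replicate)
open import Relation.Nullary using (¬_; Dec; yes; no; contradiction)
open import Relation.Binary.PropositionalEquality as ≡ using (_≡_)
open import Algebra.Bundles using (CommutativeRing; AbelianGroup)
import Algebra.Construct.DirectProduct as DirectProduct
open import Algebra.Solver.Ring.AlmostCommutativeRing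
  using (fromCommutativeRing; _-Raw-AlmostCommutative⟶_)

module IntegerCoefficientSolver {c ℓ} (R : CommutativeRing c ℓ) where
  open CommutativeRing R
  open import Algebra.Properties.Semiring.Mult.TCOptimised semiring
  open import Algebra.Properties.Ring ring using (-‿distribˡ-*; -‿distribʳ-*)
  open import Algebra.Properties.AbelianGroup +-abelianGroup using (⁻¹-∙-comm)
  open import Algebra.Properties.Group +-group using (ε⁻¹≈ε; ⁻¹-involutive)
  open import Algebra.Properties.CommutativeSemigroup +-commutativeSemigroup
    using (interchange)
  open import Relation.Binary.Reasoning.Setoid setoid

  -- Numerals are interpreted with the optimised multiple of Monoid.Mult.TCOptimised, so
  -- con (+ 0) and con (+ 1) evaluate to 0# and 1# themselves; ×ᵤ≈× relates the other
  -- numerals to the plain _×_ in which characteristics are stated.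
  ⟦_⟧ℤ : ℤ → Carrier
  ⟦ + n      ⟧ℤ = n × 1#
  ⟦ -[1+ n ] ⟧ℤ = - (suc n × 1#)

  ⟦_⟧± : Sign.Sign → Carrier → Carrier
  ⟦ Sign.+ ⟧± x = x
  ⟦ Sign.- ⟧± x = - x

  x-y≈[1+x]-[1+y] : ∀ x y → x - y ≈ (1# + x) - (1# + y)
  x-y≈[1+x]-[1+y] x y = begin
    x - y                  ≈⟨ +-identityˡ _ ⟨
    0# + (x - y)           ≈⟨ +-congʳ (-‿inverseʳ 1#) ⟨
    (1# - 1#) + (x - y)    ≈⟨ interchange 1# (- 1#) x (- y) ⟩
    (1# + x) + (- 1# - y)  ≈⟨ +-congˡ (⁻¹-∙-comm 1# y) ⟩
    (1# + x) - (1# + y)    ∎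

  ⟦⊖⟧ : ∀ m n → ⟦ m ⊖ n ⟧ℤ ≈ m × 1# - n × 1#
  ⟦⊖⟧ m       zero    = sym (trans (+-congˡ ε⁻¹≈ε) (+-identityʳ _))
  ⟦⊖⟧ zero    (suc n) = sym (+-identityˡ _)
  ⟦⊖⟧ (suc m) (suc n) = begin
    ⟦ suc m ⊖ suc n ⟧ℤ             ≡⟨ ≡.cong ⟦_⟧ℤ (ℤ.[1+m]⊖[1+n]≡m⊖n m n) ⟩
    ⟦ m ⊖ n ⟧ℤ                     ≈⟨ ⟦⊖⟧ m n ⟩
    m × 1# - n × 1#                ≈⟨ x-y≈[1+x]-[1+y] _ _ ⟩
    (1# + m × 1#) - (1# + n × 1#)  ≈⟨ +-cong (1+× m 1#) (-‿cong (1+× n 1#)) ⟨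
    suc m × 1# - suc n × 1#        ∎

  ⟦◃⟧ : ∀ s n → ⟦ s ℤ.◃ n ⟧ℤ ≈ ⟦ s ⟧± (n × 1#)
  ⟦◃⟧ Sign.+ zero    = refl
  ⟦◃⟧ Sign.- zero    = sym ε⁻¹≈ε
  ⟦◃⟧ Sign.+ (suc n) = refl
  ⟦◃⟧ Sign.- (suc n) = refl

  ⟦⟧ℤ-homo-+ : ∀ i j → ⟦ i ℤ.+ j ⟧ℤ ≈ ⟦ i ⟧ℤ + ⟦ j ⟧ℤ
  ⟦⟧ℤ-homo-+ -[1+ m ] -[1+ n ] = begin
    - (suc (suc (m ℕ.+ n)) × 1#)     ≡⟨ ≡.cong (λ k → - (k × 1#)) (ℕ.+-suc (suc m) n) ⟨
    - ((suc m ℕ.+ suc n) × 1#)       ≈⟨ -‿cong (×-homo-+ 1# (suc m) (suc n)) ⟩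
    - (suc m × 1# + suc n × 1#)      ≈⟨ ⁻¹-∙-comm _ _ ⟨
    - (suc m × 1#) + - (suc n × 1#)  ∎
  ⟦⟧ℤ-homo-+ -[1+ m ] (+ n)    = trans (⟦⊖⟧ n (suc m)) (+-comm _ _)
  ⟦⟧ℤ-homo-+ (+ m)    -[1+ n ] = ⟦⊖⟧ m (suc n)
  ⟦⟧ℤ-homo-+ (+ m)    (+ n)    = ×-homo-+ 1# m n

  ⟦⟧ℤ-homo-* : ∀ i j → ⟦ i ℤ.* j ⟧ℤ ≈ ⟦ i ⟧ℤ * ⟦ j ⟧ℤ
  ⟦⟧ℤ-homo-* -[1+ m ] -[1+ n ] = begin
    ⟦ Sign.+ ℤ.◃ (suc m ℕ.* suc n) ⟧ℤ       ≈⟨ ⟦◃⟧ Sign.+ (suc m ℕ.* suc n) ⟩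
    (suc m ℕ.* suc n) × 1#                  ≈⟨ ×1-homo-* (suc m) (suc n) ⟩
    (suc m × 1#) * (suc n × 1#)             ≈⟨ *-cong (⁻¹-involutive _) (⁻¹-involutive _) ⟨
    - - (suc m × 1#) * - - (suc n × 1#)     ≈⟨ -‿distribˡ-* _ _ ⟨
    - (- (suc m × 1#) * - - (suc n × 1#))   ≈⟨ -‿cong (-‿distribʳ-* _ _) ⟨
    - - (- (suc m × 1#) * - (suc n × 1#))   ≈⟨ ⁻¹-involutive _ ⟩
    - (suc m × 1#) * - (suc n × 1#)         ∎
  ⟦⟧ℤ-homo-* -[1+ m ] (+ n) = begin
    ⟦ Sign.- ℤ.◃ (suc m ℕ.* n) ⟧ℤ  ≈⟨ ⟦◃⟧ Sign.- (suc m ℕ.* n) ⟩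
    - ((suc m ℕ.* n) × 1#)         ≈⟨ -‿cong (×1-homo-* (suc m) n) ⟩
    - ((suc m × 1#) * (n × 1#))    ≈⟨ -‿distribˡ-* _ _ ⟩
    - (suc m × 1#) * (n × 1#)      ∎
  ⟦⟧ℤ-homo-* (+ zero)  -[1+ n ] = sym (zeroˡ _)
  ⟦⟧ℤ-homo-* (+ suc m) -[1+ n ] = begin
    ⟦ Sign.- ℤ.◃ (suc m ℕ.* suc n) ⟧ℤ  ≈⟨ ⟦◃⟧ Sign.- (suc m ℕ.* suc n) ⟩
    - ((suc m ℕ.* suc n) × 1#)         ≈⟨ -‿cong (×1-homo-* (suc m) (suc n)) ⟩
    - ((suc m × 1#) * (suc n × 1#))    ≈⟨ -‿distribʳ-* _ _ ⟩
    (suc m × 1#) * - (suc n × 1#)      ∎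
  ⟦⟧ℤ-homo-* (+ zero)  (+ n) = sym (zeroˡ _)
  ⟦⟧ℤ-homo-* (+ suc m) (+ n) = trans (⟦◃⟧ Sign.+ (suc m ℕ.* n)) (×1-homo-* (suc m) n)

  ⟦⟧ℤ-homo-‿ : ∀ i → ⟦ ℤ.- i ⟧ℤ ≈ - ⟦ i ⟧ℤ
  ⟦⟧ℤ-homo-‿ -[1+ n ]  = sym (⁻¹-involutive _)
  ⟦⟧ℤ-homo-‿ (+ zero)  = sym ε⁻¹≈ε
  ⟦⟧ℤ-homo-‿ (+ suc n) = refl

  ℤ⟶R : CommutativeRing.rawRing ℤ.+-*-commutativeRing
          -Raw-AlmostCommutative⟶ fromCommutativeRing R
  ℤ⟶R = record
    { ⟦_⟧ = ⟦_⟧ℤ ; +-homo = ⟦⟧ℤ-homo-+ ; *-homo = ⟦⟧ℤ-homo-* ; -‿homo = ⟦⟧ℤ-homo-‿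
    ; 0-homo = refl ; 1-homo = refl }

  _≟ℤ_ : ∀ i j → Maybe (⟦ i ⟧ℤ ≈ ⟦ j ⟧ℤ)
  i ≟ℤ j with i ℤ.≟ j
  ... | yes ≡.refl = just refl
  ... | no _       = nothing

  open import Algebra.Solver.Ring _ _ ℤ⟶R _≟ℤ_ public

prime∤! : ∀ {p} → Prime p → ∀ {m} → m < p → ¬ p ∣ m !
prime∤! {suc (suc _)} _ {zero} _ p∣1 with s≤s () ← ∣⇒≤ p∣1
prime∤! p-prime {suc m} m<p p∣m! with euclidsLemma (suc m) (m !) p-prime p∣m!
... | inj₁ p∣1+m = ℕ.<⇒≱ m<p (∣⇒≤ p∣1+m)
... | inj₂ p∣m!  = prime∤! p-prime (ℕ.<-trans (ℕ.n<1+n m) m<p) p∣m!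

C*k![n∸k]!≡n! : ∀ {n k} → k ≤ n → (n C k) ℕ.* (k ! ℕ.* (n ∸ k) !) ≡ n !
C*k![n∸k]!≡n! {n} {k} k≤n =
  ≡.trans (≡.cong (ℕ._* (k ! ℕ.* (n ∸ k) !)) (nCk≡n!/k![n-k]! k≤n))
          (m/n*n≡m {{k ℕ.!* (n ∸ k) !≢0}} (k![n∸k]!∣n! k≤n))

prime∣C : ∀ {p} → Prime p → ∀ {k} → 0 < k → k < p → p ∣ p C k
prime∣C {p@(suc n)} p-prime {k} 0<k k<p
  with euclidsLemma (p C k) (k ! ℕ.* (p ∸ k) !) p-prime
         (≡.subst (p ∣_) (≡.sym (C*k![n∸k]!≡n! (ℕ.<⇒≤ k<p))) (m∣m*n (n !)))
... | inj₁ p∣C = p∣C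
... | inj₂ p∣k![p∸k]! with euclidsLemma (k !) ((p ∸ k) !) p-prime p∣k![p∸k]!
...   | inj₁ p∣k!     = contradiction p∣k! (prime∤! p-prime k<p)
...   | inj₂ p∣[p∸k]! = contradiction p∣[p∸k]! (prime∤! p-prime (ℕ.∸-monoʳ-< 0<k (ℕ.<⇒≤ k<p)))

SquareResidue₅ : ℕ → Set
SquareResidue₅ r = r ≡ 0 ⊎ r ≡ 1 ⊎ r ≡ 4

SquareResidue₅-* : ∀ {a b} → SquareResidue₅ a → SquareResidue₅ b → SquareResidue₅ ((a ℕ.* b) % 5)
SquareResidue₅-* (inj₁ ≡.refl)         _                       = inj₁ ≡.refl
SquareResidue₅-* (inj₂ (inj₁ ≡.refl))  (inj₁ ≡.refl)           = inj₁ ≡.refl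
SquareResidue₅-* (inj₂ (inj₁ ≡.refl))  (inj₂ (inj₁ ≡.refl))    = inj₂ (inj₁ ≡.refl)
SquareResidue₅-* (inj₂ (inj₁ ≡.refl))  (inj₂ (inj₂ ≡.refl))    = inj₂ (inj₂ ≡.refl)
SquareResidue₅-* (inj₂ (inj₂ ≡.refl))  (inj₁ ≡.refl)           = inj₁ ≡.refl
SquareResidue₅-* (inj₂ (inj₂ ≡.refl))  (inj₂ (inj₁ ≡.refl))    = inj₂ (inj₂ ≡.refl)
SquareResidue₅-* (inj₂ (inj₂ ≡.refl))  (inj₂ (inj₂ ≡.refl))    = inj₂ (inj₁ ≡.refl)

SquareResidue₅-^ : ∀ n k → SquareResidue₅ (n % 5) → SquareResidue₅ ((n ^ℕ k) % 5)
SquareResidue₅-^ n zero    _     = inj₂ (inj₁ ≡.refl)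
SquareResidue₅-^ n (suc k) n%5-sq = ≡.subst SquareResidue₅ (≡.sym (%-distribˡ-* n (n ^ℕ k) 5))
  (SquareResidue₅-* n%5-sq (SquareResidue₅-^ n k n%5-sq))

SquareResidue₅⇒≢2∨3 : ∀ {r} → SquareResidue₅ r → ¬ (r ≡ 2 ⊎ r ≡ 3)
SquareResidue₅⇒≢2∨3 (inj₁ ≡.refl)        (inj₁ ())
SquareResidue₅⇒≢2∨3 (inj₁ ≡.refl)        (inj₂ ())
SquareResidue₅⇒≢2∨3 (inj₂ (inj₁ ≡.refl)) (inj₁ ())
SquareResidue₅⇒≢2∨3 (inj₂ (inj₁ ≡.refl)) (inj₂ ())
SquareResidue₅⇒≢2∨3 (inj₂ (inj₂ ≡.refl)) (inj₁ ())
SquareResidue₅⇒≢2∨3 (inj₂ (inj₂ ≡.refl)) (inj₂ ())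

residue₅-cases : ∀ n → SquareResidue₅ (n % 5) ⊎ (n % 5 ≡ 2 ⊎ n % 5 ≡ 3)
residue₅-cases n = cases (n % 5) (m%n<n n 5)
  where
  cases : ∀ r → r < 5 → SquareResidue₅ r ⊎ (r ≡ 2 ⊎ r ≡ 3)
  cases 0 _ = inj₁ (inj₁ ≡.refl)
  cases 1 _ = inj₁ (inj₂ (inj₁ ≡.refl))
  cases 2 _ = inj₂ (inj₁ ≡.refl)
  cases 3 _ = inj₂ (inj₂ ≡.refl)
  cases 4 _ = inj₁ (inj₂ (inj₂ ≡.refl))
  cases (suc (suc (suc (suc (suc _))))) (s≤s (s≤s (s≤s (s≤s (s≤s ())))))

^-%5≡2∨3⇒%5≡2∨3 : ∀ n k → (n ^ℕ k) % 5 ≡ 2 ⊎ (n ^ℕ k) % 5 ≡ 3 → n % 5 ≡ 2 ⊎ n % 5 ≡ 3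
^-%5≡2∨3⇒%5≡2∨3 n k nᵏ%5≡2∨3 with residue₅-cases n
... | inj₁ n%5-sq   = contradiction nᵏ%5≡2∨3 (SquareResidue₅⇒≢2∨3 (SquareResidue₅-^ n k n%5-sq))
... | inj₂ n%5≡2∨3 = n%5≡2∨3

Fin-injective⇒surjective : ∀ {n} (f : Fin n → Fin n) → (∀ {i j} → f i ≡ f j → i ≡ j) →
                           ∀ j → Σ (Fin n) λ i → f i ≡ j
Fin-injective⇒surjective {suc n} f f-inj j with Fin.any? (λ i → f i Fin.≟ j)
... | yes hit = hit
... | no miss = contradiction (Fin.injective⇒≤ g-inj) ℕ.1+n≰n
  where
  g : Fin (suc n) → Fin n
  g i = punchOut {i = j} (λ j≡fi → miss (i , ≡.sym j≡fi))
  g-inj : ∀ {a b} → g a ≡ g b → a ≡ b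
  g-inj {a} {b} ga≡gb = f-inj (Fin.punchOut-injective {i = j} _ _ ga≡gb)

module CommutativeRingProperties {c ℓ} (R : CommutativeRing c ℓ) where
  open CommutativeRing R
  open import Algebra.Properties.Semiring.Mult semiring
  open import Algebra.Properties.CommutativeSemiring.Exp commutativeSemiring
  open import Algebra.Properties.Monoid.Sum +-monoid
    using (sum; sum-init-last; sum-cong-≋; sum-replicate-zero)
  open import Algebra.Properties.CommutativeSemiring.Binomial commutativeSemiring
    using (theorem; binomialTerm)
  open import Algebra.Properties.Group +-group using (inverseʳ-unique)
  open import Relation.Binary.Reasoning.Setoid setoid

  ×1≈0⇒×≈0 : ∀ {n} → n × 1# ≈ 0# → ∀ x → n × x ≈ 0#
  ×1≈0⇒×≈0 {n} n≈0 x = begin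
    n × x         ≈⟨ ×-congʳ n (*-identityˡ x) ⟨
    n × (1# * x)  ≈⟨ ×-assoc-* n 1# x ⟨
    (n × 1#) * x  ≈⟨ *-congʳ n≈0 ⟩
    0# * x        ≈⟨ zeroˡ x ⟩
    0#            ∎

  ∣-×1≈0 : ∀ {m n} → m ∣ n → m × 1# ≈ 0# → n × 1# ≈ 0#
  ∣-×1≈0 {m} (divides k ≡.refl) m≈0 = begin
    (k ℕ.* m) × 1#       ≈⟨ ×1-homo-* k m ⟩
    (k × 1#) * (m × 1#)  ≈⟨ *-congˡ m≈0 ⟩
    (k × 1#) * 0#        ≈⟨ zeroʳ _ ⟩
    0#                   ∎

  ×1≈0-% : ∀ {n} m .{{_ : NonZero m}} → n × 1# ≈ 0# → m × 1# ≈ 0# → (n % m) × 1# ≈ 0#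
  ×1≈0-% {n} m n≈0 m≈0 = begin
    (n % m) × 1#                              ≈⟨ +-identityʳ _ ⟨
    (n % m) × 1# + 0#                         ≈⟨ +-congˡ (∣-×1≈0 (n∣m*n (n / m)) m≈0) ⟨
    (n % m) × 1# + (n / m ℕ.* m) × 1#         ≈⟨ ×-homo-+ 1# (n % m) (n / m ℕ.* m) ⟨
    (n % m ℕ.+ n / m ℕ.* m) × 1#              ≡⟨ ≡.cong (_× 1#) (m≡m%n+[m/n]*n n m) ⟨
    n × 1#                                    ≈⟨ n≈0 ⟩
    0#                                        ∎

  -- Each solver certificate below writes z as w plus multiples c of known relations
  -- x ≈ y; this discards one such multiple.
  ≈-modulo : ∀ {x y z w} c → x ≈ y → z ≈ w + (x - y) * c → z ≈ w
  ≈-modulo {x} {y} {z} {w} c x≈y z≈w+[x-y]c = begin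
    z                ≈⟨ z≈w+[x-y]c ⟩
    w + (x - y) * c  ≈⟨ +-congˡ (*-congʳ (+-congʳ x≈y)) ⟩
    w + (y - y) * c  ≈⟨ +-congˡ (*-congʳ (-‿inverseʳ y)) ⟩
    w + 0# * c       ≈⟨ +-congˡ (zeroˡ c) ⟩
    w + 0#           ≈⟨ +-identityʳ w ⟩
    w                ∎

  *-unit-cancel : ∀ {x u v} → x * u ≈ 0# → u * v ≈ 1# → x ≈ 0#
  *-unit-cancel {x} {u} {v} xu≈0 uv≈1 = begin
    x             ≈⟨ *-identityʳ x ⟨
    x * 1#        ≈⟨ *-congˡ uv≈1 ⟨
    x * (u * v)   ≈⟨ *-assoc x u v ⟨
    (x * u) * v   ≈⟨ *-congʳ xu≈0 ⟩
    0# * v        ≈⟨ zeroˡ v ⟩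
    0#            ∎

  1^n≈1 : ∀ n → 1# ^ n ≈ 1#
  1^n≈1 zero    = refl
  1^n≈1 (suc n) = trans (*-identityˡ _) (1^n≈1 n)

  0^prime≈0 : ∀ {p} → Prime p → 0# ^ p ≈ 0#
  0^prime≈0 {suc _} _ = zeroˡ _

  x^n≈x^[n%m] : ∀ {x} m .{{_ : NonZero m}} → x ^ m ≈ 1# → ∀ n → x ^ n ≈ x ^ (n % m)
  x^n≈x^[n%m] {x} m x^m≈1 n = begin
    x ^ n                              ≡⟨ ≡.cong (x ^_) (m≡m%n+[m/n]*n n m) ⟩
    x ^ (n % m ℕ.+ n / m ℕ.* m)        ≈⟨ ^-homo-* x (n % m) (n / m ℕ.* m) ⟩
    x ^ (n % m) * x ^ (n / m ℕ.* m)    ≡⟨ ≡.cong (λ k → x ^ (n % m) * x ^ k) (ℕ.*-comm (n / m) m) ⟩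
    x ^ (n % m) * x ^ (m ℕ.* (n / m))  ≈⟨ *-congˡ (^-assocʳ x m (n / m)) ⟨
    x ^ (n % m) * (x ^ m) ^ (n / m)    ≈⟨ *-congˡ (^-congˡ (n / m) x^m≈1) ⟩
    x ^ (n % m) * 1# ^ (n / m)         ≈⟨ *-congˡ (1^n≈1 (n / m)) ⟩
    x ^ (n % m) * 1#                   ≈⟨ *-identityʳ _ ⟩
    x ^ (n % m)                        ∎

  freshman : ∀ {p} → Prime p → p × 1# ≈ 0# → ∀ x y → (x + y) ^ p ≈ x ^ p + y ^ p
  freshman {p@(suc (suc n))} p-prime char x y = begin
    (x + y) ^ p                                       ≈⟨ theorem p x y ⟩
    term Fin.zero + sum (λ i → term (Fin.suc i))      ≈⟨ +-congˡ (sum-init-last (λ i → term (Fin.suc i))) ⟩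
    term Fin.zero + (sum inner + term last)           ≈⟨ +-congˡ (+-congʳ inner≈0) ⟩
    term Fin.zero + (0# + term last)                  ≈⟨ +-congˡ (+-identityˡ _) ⟩
    term Fin.zero + term last                         ≈⟨ +-cong first≈y^p last≈x^p ⟩
    y ^ p + x ^ p                                     ≈⟨ +-comm _ _ ⟩
    x ^ p + y ^ p                                     ∎
    where
    term : Fin (suc p) → Carrier
    term = binomialTerm x y p
    last : Fin (suc p)
    last = Fin.suc (fromℕ (suc n))
    inner : Fin (suc n) → Carrier
    inner i = term (Fin.suc (inject₁ i))
    inner≈0 : sum inner ≈ 0#
    inner≈0 = trans (sum-cong-≋ inner≈0ᵢ) (sum-replicate-zero (suc n))
      where
      inner≈0ᵢ : ∀ i → inner i ≈ 0#
      inner≈0ᵢ i = ×1≈0⇒×≈0 {p C toℕ (Fin.suc (inject₁ i))}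
                     (∣-×1≈0 (prime∣C p-prime (s≤s z≤n) i<p) char) _
        where
        i<p : toℕ (Fin.suc (inject₁ i)) < p
        i<p = s≤s (≡.subst (_< suc n) (≡.sym (Fin.toℕ-inject₁ i)) (Fin.toℕ<n i))
    first≈y^p : term Fin.zero ≈ y ^ p
    first≈y^p = trans (+-identityʳ _) (*-identityˡ _)
    last≈x^p : term last ≈ x ^ p
    last≈x^p = begin
      (p C toℕ (fromℕ p)) × (x ^ toℕ (fromℕ p) * y ^ (p ∸ toℕ (fromℕ p)))
        ≡⟨ ≡.cong (λ k → (p C k) × (x ^ k * y ^ (p ∸ k))) (Fin.toℕ-fromℕ p) ⟩
      (p C p) × (x ^ p * y ^ (p ∸ p))
        ≡⟨ ≡.cong₂ (λ a b → a × (x ^ p * y ^ b)) (nCn≡1 p) (ℕ.n∸n≡0 p) ⟩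
      1 × (x ^ p * 1#)  ≈⟨ +-identityʳ _ ⟩
      x ^ p * 1#        ≈⟨ *-identityʳ _ ⟩
      x ^ p             ∎

  -x^p≈-[x^p] : ∀ {p} → Prime p → p × 1# ≈ 0# → ∀ x → (- x) ^ p ≈ - (x ^ p)
  -x^p≈-[x^p] {p} p-prime char x = inverseʳ-unique (x ^ p) ((- x) ^ p) (begin
    x ^ p + (- x) ^ p   ≈⟨ freshman p-prime char x (- x) ⟨
    (x - x) ^ p         ≈⟨ ^-congˡ p (-‿inverseʳ x) ⟩
    0# ^ p              ≈⟨ 0^prime≈0 p-prime ⟩
    0#                  ∎)

module GoldenRoots {c ℓ} (S : CommutativeRing c ℓ) (Θ : CommutativeRing.Carrier S) where

  open CommutativeRing S

  open import Algebra.Properties.Semiring.Mult semiring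
  open import Algebra.Properties.Monoid.Mult.TCOptimised +-monoid using (×ᵤ≈×)
  open import Algebra.Properties.CommutativeSemiring.Exp commutativeSemiring
  open import Relation.Binary.Reasoning.Setoid setoid
  open IntegerCoefficientSolver S using (⟦_⟧ℤ; solve; _:=_; _:+_; _:*_; _:-_; _:^_; con)
  open CommutativeRingProperties S

  Root : Carrier → Set ℓ
  Root u = u * u + 1# ≈ Θ * u

  Root-cong : ∀ {u v} → u ≈ v → Root u → Root v
  Root-cong {u} {v} u≈v root-u = begin
    v * v + 1#  ≈⟨ +-congʳ (*-cong u≈v u≈v) ⟨
    u * u + 1#  ≈⟨ root-u ⟩
    Θ * u       ≈⟨ *-congˡ u≈v ⟩
    Θ * v       ∎

  module _ (golden : Θ * Θ + Θ ≈ 1#) {t} (root : Root t) where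

    -- t⁴ + t³ + t² + t + 1 = (t² − Θt + 1)(t² + (1 + Θ)t + 1) + (Θ² + Θ − 1)t²
    t⁵≈1 : t ^ 5 ≈ 1#
    t⁵≈1 = ≈-modulo _ golden (≈-modulo _ root
      (solve 2 (λ t Θ → t :^ 5
        := con (+ 1) :+ (Θ :* Θ :+ Θ :- con (+ 1)) :* ((t :- con (+ 1)) :* (t :* t))
                     :+ (t :* t :+ con (+ 1) :- Θ :* t)
                        :* ((t :- con (+ 1)) :* (t :* t :+ (con (+ 1) :+ Θ) :* t :+ con (+ 1))))
        refl t Θ))

    -- Modulo the relations, (t²)² + 1 − Θt² = −(1 + 2Θ)t²; t is a unit with inverse Θ − t,
    -- and (1 + 2Θ)² = 5 + 4(Θ² + Θ − 1).
    t²-root⇒5≈0 : Root (t ^ 2) → 5 × 1# ≈ 0#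
    t²-root⇒5≈0 root-t² = trans (×ᵤ≈× 5 1#) (≈-modulo _ golden (≈-modulo _ 1+2Θ≈0
      (solve 1 (λ Θ → con (+ 5) := con (+ 0) :+ (Θ :* Θ :+ Θ :- con (+ 1)) :* con -[1+ 3 ]
                     :+ (con (+ 1) :+ Θ :+ Θ :- con (+ 0)) :* (con (+ 1) :+ Θ :+ Θ))
        refl Θ)))
      where
      [1+2Θ]t²≈0 : (1# + Θ + Θ) * t ^ 2 ≈ 0#
      [1+2Θ]t²≈0 = ≈-modulo _ golden (≈-modulo _ root (≈-modulo _ root-t²
        (solve 2 (λ t Θ → (con (+ 1) :+ Θ :+ Θ) :* t :^ 2
          := con (+ 0) :+ (Θ :* Θ :+ Θ :- con (+ 1)) :* (t :* t)
                       :+ (t :* t :+ con (+ 1) :- Θ :* t) :* (t :* t :+ Θ :* t :+ con (+ 1))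
                       :+ (t :^ 2 :* t :^ 2 :+ con (+ 1) :- Θ :* t :^ 2) :* con -[1+ 0 ])
          refl t Θ)))
      t²[Θ-t]²≈1 : t ^ 2 * (Θ - t) ^ 2 ≈ 1#
      t²[Θ-t]²≈1 = ≈-modulo _ root
        (solve 2 (λ t Θ → t :^ 2 :* (Θ :- t) :^ 2
          := con (+ 1) :+ (t :* t :+ con (+ 1) :- Θ :* t) :* (t :* t :+ con (+ 1) :- Θ :* t :- con (+ 2)))
          refl t Θ)
      1+2Θ≈0 : 1# + Θ + Θ ≈ 0#
      1+2Θ≈0 = *-unit-cancel [1+2Θ]t²≈0 t²[Θ-t]²≈1

    -- t³ = t⁻² as t⁵ = 1, and the inverse of a root of X² − ΘX + 1 is again a root.
    t³-root⇒t²-root : Root (t ^ 3) → Root (t ^ 2)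
    t³-root⇒t²-root root-t³ = ≈-modulo _ t⁵≈1 (≈-modulo _ root-t³
      (solve 2 (λ t Θ → t :^ 2 :* t :^ 2 :+ con (+ 1)
        := Θ :* t :^ 2 :+ (t :^ 5 :- con (+ 1)) :* (Θ :* t :^ 2 :- t :^ 5 :- con (+ 1))
                       :+ (t :^ 3 :* t :^ 3 :+ con (+ 1) :- Θ :* t :^ 3) :* t :^ 4)
        refl t Θ))

    frobenius-root : ∀ {p} → Prime p → p × 1# ≈ 0# → Θ ^ p ≈ Θ → Root (t ^ p)
    frobenius-root {p} p-prime char Θ^p≈Θ = begin
      t ^ p * t ^ p + 1#     ≈⟨ +-cong (^-distrib-* t t p) (1^n≈1 p) ⟨
      (t * t) ^ p + 1# ^ p   ≈⟨ freshman p-prime char (t * t) 1# ⟨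
      (t * t + 1#) ^ p       ≈⟨ ^-congˡ p root ⟩
      (Θ * t) ^ p            ≈⟨ ^-distrib-* Θ t p ⟩
      Θ ^ p * t ^ p          ≈⟨ *-congʳ Θ^p≈Θ ⟩
      Θ * t ^ p              ∎

    frobenius-fixed⇒1≈0 : ∀ {p} → Prime p → p × 1# ≈ 0# → p % 5 ≡ 2 ⊎ p % 5 ≡ 3 →
                          Θ ^ p ≈ Θ → 1# ≈ 0#
    frobenius-fixed⇒1≈0 {p} p-prime char p%5≡2∨3 Θ^p≈Θ = 1≈0 p%5≡2∨3
      where
      root-t^[p%5] : Root (t ^ (p % 5))
      root-t^[p%5] = Root-cong (x^n≈x^[n%m] 5 t⁵≈1 p) (frobenius-root p-prime char Θ^p≈Θ)
      numeral : ∀ n → n × 1# ≈ 0# → ⟦ + n ⟧ℤ ≈ 0#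
      numeral n n≈0 = trans (sym (×ᵤ≈× n 1#)) n≈0
      1≈0 : p % 5 ≡ 2 ⊎ p % 5 ≡ 3 → 1# ≈ 0#
      1≈0 (inj₁ p%5≡2) = ≈-modulo _ (numeral 5 5≈0) (≈-modulo _ (numeral 2 2≈0)
        (solve 0 (con (+ 1) := con (+ 0) :+ (con (+ 5) :- con (+ 0)) :* con (+ 1)
                                         :+ (con (+ 2) :- con (+ 0)) :* con -[1+ 1 ]) refl))
        where
        5≈0 : 5 × 1# ≈ 0#
        5≈0 = t²-root⇒5≈0 (≡.subst (λ r → Root (t ^ r)) p%5≡2 root-t^[p%5])
        2≈0 : 2 × 1# ≈ 0#
        2≈0 = ≡.subst (λ r → r × 1# ≈ 0#) p%5≡2 (×1≈0-% {p} 5 char 5≈0)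
      1≈0 (inj₂ p%5≡3) = ≈-modulo _ (numeral 5 5≈0) (≈-modulo _ (numeral 3 3≈0)
        (solve 0 (con (+ 1) := con (+ 0) :+ (con (+ 5) :- con (+ 0)) :* con -[1+ 0 ]
                                         :+ (con (+ 3) :- con (+ 0)) :* con (+ 2)) refl))
        where
        5≈0 : 5 × 1# ≈ 0#
        5≈0 = t²-root⇒5≈0 (t³-root⇒t²-root (≡.subst (λ r → Root (t ^ r)) p%5≡3 root-t^[p%5]))
        3≈0 : 3 × 1# ≈ 0#
        3≈0 = ≡.subst (λ r → r × 1# ≈ 0#) p%5≡3 (×1≈0-% {p} 5 char 5≈0)

module QuadraticExtension {c ℓ} (K : CommutativeRing c ℓ) (θ : CommutativeRing.Carrier K) where

  open CommutativeRing K

  open IntegerCoefficientSolver K using (solve; Polynomial; _:=_; _:+_; _:*_; _:-_; con)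

  private
    module G = AbelianGroup (DirectProduct.abelianGroup +-abelianGroup +-abelianGroup)

  -- (a , b) stands for a + b t, where t² = θ t − 1.
  _*ₜ_ : G.Carrier → G.Carrier → G.Carrier
  (a , b) *ₜ (c , d) = (a * c - b * d , a * d + b * c + θ * (b * d))

  -- _*ₜ_ on solver expressions, so that each law of K[t] is a pair of identities in K.
  private
    Coordinates : ℕ → Set
    Coordinates n = Product._×_ (Polynomial n) (Polynomial n)

    _+ₚ_ : ∀ {n} → Coordinates n → Coordinates n → Coordinates n
    (a , b) +ₚ (c , d) = (a :+ c , b :+ d)

    mulₚ : ∀ {n} → Polynomial n → Coordinates n → Coordinates n → Coordinates n
    mulₚ θ (a , b) (c , d) = (a :* c :- b :* d , a :* d :+ b :* c :+ θ :* (b :* d))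

  *ₜ-cong : ∀ {x y u v} → x G.≈ y → u G.≈ v → (x *ₜ u) G.≈ (y *ₜ v)
  *ₜ-cong (a≈ , b≈) (c≈ , d≈) =
    +-cong (*-cong a≈ c≈) (-‿cong (*-cong b≈ d≈)) ,
    +-cong (+-cong (*-cong a≈ d≈) (*-cong b≈ c≈)) (*-congˡ (*-cong b≈ d≈))

  *ₜ-assoc : ∀ x y z → ((x *ₜ y) *ₜ z) G.≈ (x *ₜ (y *ₜ z))
  *ₜ-assoc (a , b) (c , d) (e , f) =
    solve 7 (λ a b c d e f θ → proj₁ (mulₚ θ (mulₚ θ (a , b) (c , d)) (e , f))
                            := proj₁ (mulₚ θ (a , b) (mulₚ θ (c , d) (e , f)))) refl a b c d e f θ ,
    solve 7 (λ a b c d e f θ → proj₂ (mulₚ θ (mulₚ θ (a , b) (c , d)) (e , f))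
                            := proj₂ (mulₚ θ (a , b) (mulₚ θ (c , d) (e , f)))) refl a b c d e f θ

  *ₜ-comm : ∀ x y → (x *ₜ y) G.≈ (y *ₜ x)
  *ₜ-comm (a , b) (c , d) =
    solve 5 (λ a b c d θ → proj₁ (mulₚ θ (a , b) (c , d)) := proj₁ (mulₚ θ (c , d) (a , b)))
      refl a b c d θ ,
    solve 5 (λ a b c d θ → proj₂ (mulₚ θ (a , b) (c , d)) := proj₂ (mulₚ θ (c , d) (a , b)))
      refl a b c d θ

  *ₜ-identityˡ : ∀ x → ((1# , 0#) *ₜ x) G.≈ x
  *ₜ-identityˡ (a , b) =
    solve 3 (λ a b θ → proj₁ (mulₚ θ (con (+ 1) , con (+ 0)) (a , b)) := a) refl a b θ ,
    solve 3 (λ a b θ → proj₂ (mulₚ θ (con (+ 1) , con (+ 0)) (a , b)) := b) refl a b θ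

  *ₜ-identityʳ : ∀ x → (x *ₜ (1# , 0#)) G.≈ x
  *ₜ-identityʳ x = G.trans (*ₜ-comm x (1# , 0#)) (*ₜ-identityˡ x)

  *ₜ-distribˡ : ∀ x y z → (x *ₜ (y G.∙ z)) G.≈ ((x *ₜ y) G.∙ (x *ₜ z))
  *ₜ-distribˡ (a , b) (c , d) (e , f) =
    solve 7 (λ a b c d e f θ → proj₁ (mulₚ θ (a , b) ((c , d) +ₚ (e , f)))
                            := proj₁ (mulₚ θ (a , b) (c , d) +ₚ mulₚ θ (a , b) (e , f))) refl a b c d e f θ ,
    solve 7 (λ a b c d e f θ → proj₂ (mulₚ θ (a , b) ((c , d) +ₚ (e , f)))
                            := proj₂ (mulₚ θ (a , b) (c , d) +ₚ mulₚ θ (a , b) (e , f))) refl a b c d e f θ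

  *ₜ-distribʳ : ∀ x y z → ((y G.∙ z) *ₜ x) G.≈ ((y *ₜ x) G.∙ (z *ₜ x))
  *ₜ-distribʳ x y z = G.trans (*ₜ-comm (y G.∙ z) x)
    (G.trans (*ₜ-distribˡ x y z) (G.∙-cong (*ₜ-comm x y) (*ₜ-comm x z)))

  K[t] : CommutativeRing c ℓ
  K[t] = record
    { Carrier = G.Carrier
    ; _≈_ = G._≈_
    ; _+_ = G._∙_
    ; _*_ = _*ₜ_
    ; -_ = G._⁻¹
    ; 0# = G.ε
    ; 1# = (1# , 0#)
    ; isCommutativeRing = record
      { isRing = record
        { +-isAbelianGroup = G.isAbelianGroup
        ; *-cong = *ₜ-cong
        ; *-assoc = *ₜ-assoc
        ; *-identity = *ₜ-identityˡ , *ₜ-identityʳ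
        ; distrib = *ₜ-distribˡ , *ₜ-distribʳ
        }
      ; *-comm = *ₜ-comm
      }
    }

  private
    module T where
      open CommutativeRing K[t] public
      open import Algebra.Properties.Semiring.Mult (CommutativeRing.semiring K[t]) public
      open import Algebra.Properties.Semiring.Exp (CommutativeRing.semiring K[t]) public
  open import Algebra.Properties.Semiring.Mult semiring
  open import Algebra.Properties.Semiring.Exp semiring

  ι : Carrier → T.Carrier
  ι a = (a , 0#)

  t : T.Carrier
  t = (0# , 1#)

  t-root : t T.* t T.+ T.1# T.≈ ι θ T.* t
  t-root = solve 1 (λ θ → proj₁ (mulₚ θ tₚ tₚ +ₚ (con (+ 1) , con (+ 0)))
                        := proj₁ (mulₚ θ (θ , con (+ 0)) tₚ)) refl θ
         , solve 1 (λ θ → proj₂ (mulₚ θ tₚ tₚ +ₚ (con (+ 1) , con (+ 0)))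
                        := proj₂ (mulₚ θ (θ , con (+ 0)) tₚ)) refl θ
    where
    tₚ : Coordinates 1
    tₚ = (con (+ 0) , con (+ 1))

  ι-homo-* : ∀ a b → ι (a * b) T.≈ ι a T.* ι b
  ι-homo-* a b = solve 3 (λ a b θ → a :* b := proj₁ (mulₚ θ (a , con (+ 0)) (b , con (+ 0)))) refl a b θ
               , solve 3 (λ a b θ → con (+ 0) := proj₂ (mulₚ θ (a , con (+ 0)) (b , con (+ 0)))) refl a b θ

  ι-homo-^ : ∀ a n → ι (a ^ n) T.≈ ι a T.^ n
  ι-homo-^ a zero    = refl , refl
  ι-homo-^ a (suc n) = T.trans (ι-homo-* a (a ^ n)) (T.*-congˡ (ι-homo-^ a n))

  ι-homo-×1 : ∀ n → n T.× T.1# T.≈ ι (n × 1#)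
  ι-homo-×1 zero    = refl , refl
  ι-homo-×1 (suc n) = T.trans (T.+-congˡ (ι-homo-×1 n)) (refl , +-identityˡ 0#)

  golden-fixed-by-frobenius⇒1≈0 : θ * θ + θ ≈ 1# → ∀ {p} → Prime p → p × 1# ≈ 0# →
                               p % 5 ≡ 2 ⊎ p % 5 ≡ 3 → θ ^ p ≈ θ → 1# ≈ 0#
  golden-fixed-by-frobenius⇒1≈0 golden {p} p-prime char p%5≡2∨3 θ^p≈θ =
    proj₁ (GoldenRoots.frobenius-fixed⇒1≈0 K[t] (ι θ) ιθ-golden t-root p-prime
             (T.trans (ι-homo-×1 p) (char , refl)) p%5≡2∨3
             (T.trans (T.sym (ι-homo-^ θ p)) (θ^p≈θ , refl)))
    where
    ιθ-golden : ι θ T.* ι θ T.+ ι θ T.≈ T.1#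
    ιθ-golden = T.trans (T.+-congʳ (T.sym (ι-homo-* θ θ))) (golden , +-identityˡ 0#)

module FieldProperties {c ℓ} (F : Field c ℓ) where
  open Field F
  open IntegerCoefficientSolver commRing using (solve; _:=_; _:+_; _:*_; _:-_; con)
  open import Algebra.Properties.Group +-group using (x∙y⁻¹≈ε⇒x≈y)
  open import Relation.Binary.Reasoning.Setoid setoid
  open import Algebra.Properties.Semiring.Mult semiring using (_×_)
  open import Algebra.Properties.CommutativeSemiring.Exp commutativeSemiring using (_^_; ^-congˡ; ^-distrib-*)
  open CommutativeRingProperties commRing using (≈-modulo; freshman; 1^n≈1)

  x≉0⇒x*y≈0⇒y≈0 : ∀ {x y} → ¬ x ≈ 0# → x * y ≈ 0# → y ≈ 0#
  x≉0⇒x*y≈0⇒y≈0 {x} {y} x≉0 xy≈0 with inverse x x≉0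
  ... | x⁻¹ , xx⁻¹≈1 = begin
    y             ≈⟨ *-identityˡ y ⟨
    1# * y        ≈⟨ *-congʳ (trans (*-comm x⁻¹ x) xx⁻¹≈1) ⟨
    (x⁻¹ * x) * y ≈⟨ *-assoc x⁻¹ x y ⟩
    x⁻¹ * (x * y) ≈⟨ *-congˡ xy≈0 ⟩
    x⁻¹ * 0#      ≈⟨ zeroʳ x⁻¹ ⟩
    0#            ∎

  x²+x≈y²+y⇒x+y+1≈0 : ∀ {x y} → ¬ x ≈ y → x * x + x ≈ y * y + y → x + y + 1# ≈ 0#
  x²+x≈y²+y⇒x+y+1≈0 {x} {y} x≉y x²+x≈y²+y =
    x≉0⇒x*y≈0⇒y≈0 (λ x-y≈0 → x≉y (x∙y⁻¹≈ε⇒x≈y x y x-y≈0)) (begin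
      (x - y) * (x + y + 1#)        ≈⟨ solve 2 (λ x y → (x :- y) :* (x :+ y :+ con (+ 1))
                                          := (x :* x :+ x) :- (y :* y :+ y)) refl x y ⟩
      (x * x + x) - (y * y + y)     ≈⟨ +-congʳ x²+x≈y²+y ⟩
      (y * y + y) - (y * y + y)     ≈⟨ -‿inverseʳ _ ⟩
      0#                            ∎)

  x²+x≈y²+y≈z²+z⇒y≈z : ∀ {x y z} → ¬ x ≈ y → ¬ x ≈ z →
                        x * x + x ≈ y * y + y → x * x + x ≈ z * z + z → y ≈ z
  x²+x≈y²+y≈z²+z⇒y≈z {x} {y} {z} x≉y x≉z x²+x≈y²+y x²+x≈z²+z =
    ≈-modulo _ (x²+x≈y²+y⇒x+y+1≈0 x≉z x²+x≈z²+z)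
      (≈-modulo _ (x²+x≈y²+y⇒x+y+1≈0 x≉y x²+x≈y²+y)
        (solve 3 (λ x y z → y := z :+ (x :+ z :+ con (+ 1) :- con (+ 0)) :* con -[1+ 0 ]
                                   :+ (x :+ y :+ con (+ 1) :- con (+ 0)) :* con (+ 1)) refl x y z))

  golden^p≈conjugate : ∀ {p} → Prime p → p × 1# ≈ 0# → p % 5 ≡ 2 ⊎ p % 5 ≡ 3 →
                     ∀ {θ δ} → θ * θ + θ ≈ 1# → δ * δ + δ ≈ 1# → ¬ θ ≈ δ → θ ^ p ≈ δ
  golden^p≈conjugate {p} p-prime char p%5≡2∨3 {θ} {δ} θ-golden δ-golden θ≉δ =
    x²+x≈y²+y≈z²+z⇒y≈z θ≉θ^p θ≉δ
      (trans θ-golden (sym θ^p-golden)) (trans θ-golden (sym δ-golden))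
    where
    θ^p-golden : θ ^ p * θ ^ p + θ ^ p ≈ 1#
    θ^p-golden = begin
      θ ^ p * θ ^ p + θ ^ p  ≈⟨ +-congʳ (^-distrib-* θ θ p) ⟨
      (θ * θ) ^ p + θ ^ p    ≈⟨ freshman p-prime char (θ * θ) θ ⟨
      (θ * θ + θ) ^ p        ≈⟨ ^-congˡ p θ-golden ⟩
      1# ^ p                 ≈⟨ 1^n≈1 p ⟩
      1#                     ∎
    θ≉θ^p : ¬ θ ≈ θ ^ p
    θ≉θ^p θ≈θ^p = 1≉0 (QuadraticExtension.golden-fixed-by-frobenius⇒1≈0 commRing θ
                         θ-golden p-prime char p%5≡2∨3 (sym θ≈θ^p))

module FiniteField {c ℓ} (F : Field c ℓ) {N} (size : FieldTheory.HasSize F N) where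
  open Field F
  open FieldTheory F using (Automorphism)
  open FieldProperties F using (x≉0⇒x*y≈0⇒y≈0)
  open import Algebra.Properties.Semiring.Mult semiring
  open import Algebra.Properties.CommutativeSemiring.Exp commutativeSemiring
  open import Algebra.Properties.Monoid.Sum +-monoid using (sum; sum-replicate; sum-cong-≋)
  open import Algebra.Properties.CommutativeMonoid.Sum +-commutativeMonoid using (sum-permute; ∑-distrib-+)
  open import Algebra.Properties.Group +-group using (x∙y⁻¹≈ε⇒x≈y; ∙-cancelʳ)
  open import Relation.Binary.Reasoning.Setoid setoid
  open IntegerCoefficientSolver commRing using (solve; _:=_; _:+_; _:-_; con)
  open CommutativeRingProperties commRing using (1^n≈1; freshman; -x^p≈-[x^p])

  private
    e : Fin N → Carrier
    e = proj₁ size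
    e-injective : ∀ {i j} → e i ≈ e j → i ≡ j
    e-injective = proj₁ (proj₂ size) _ _
    index : Carrier → Fin N
    index x = proj₁ (proj₂ (proj₂ size) x)
    e-index : ∀ x → e (index x) ≈ x
    e-index x = proj₂ (proj₂ (proj₂ size) x)

  _≟_ : ∀ x y → Dec (x ≈ y)
  x ≟ y with index x Fin.≟ index y
  ... | yes ix≡iy = yes (trans (sym (e-index x)) (trans (reflexive (≡.cong e ix≡iy)) (e-index y)))
  ... | no  ix≢iy = no (λ x≈y → ix≢iy (e-injective (trans (e-index x) (trans x≈y (sym (e-index y))))))

  injective⇒surjective : ∀ (f : Carrier → Carrier) → (∀ {x y} → f x ≈ f y → x ≈ y) →
                         ∀ y → Σ Carrier λ x → f x ≈ y
  injective⇒surjective f f-inj y with Fin-injective⇒surjective f̂ f̂-inj (index y)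
    where
    f̂ : Fin N → Fin N
    f̂ i = index (f (e i))
    f̂-inj : ∀ {i j} → f̂ i ≡ f̂ j → i ≡ j
    f̂-inj {i} {j} f̂i≡f̂j = e-injective (f-inj (begin
      f (e i)       ≈⟨ e-index _ ⟨
      e (f̂ i)       ≡⟨ ≡.cong e f̂i≡f̂j ⟩
      e (f̂ j)       ≈⟨ e-index _ ⟩
      f (e j)       ∎))
  ... | i , f̂i≡iy = e i , (begin
      f (e i)             ≈⟨ e-index _ ⟨
      e (index (f (e i))) ≡⟨ ≡.cong e f̂i≡iy ⟩
      e (index y)         ≈⟨ e-index y ⟩
      y                   ∎)

  -- Translation by 1 permutes the elements, so Σ x = Σ (1 + x) = N + Σ x.
  N×1≈0 : N × 1# ≈ 0#
  N×1≈0 = ∙-cancelʳ (sum e) (N × 1#) 0# (begin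
    N × 1# + sum e                 ≈⟨ +-congʳ (sum-replicate N) ⟨
    sum (replicate N 1#) + sum e   ≈⟨ ∑-distrib-+ (replicate N 1#) e ⟨
    sum (λ i → 1# + e i)           ≈⟨ sum-cong-≋ (λ i → e-index (1# + e i)) ⟨
    sum (λ i → e (shift i))        ≈⟨ sum-permute e (permutation shift unshift shift∘unshift unshift∘shift) ⟨
    sum e                          ≈⟨ +-identityˡ _ ⟨
    0# + sum e                     ∎)
    where
    shift unshift : Fin N → Fin N
    shift   i = index (1# + e i)
    unshift i = index (e i - 1#)
    shift∘unshift : ∀ i → shift (unshift i) ≡ i
    shift∘unshift i = e-injective (begin
      e (shift (unshift i))  ≈⟨ e-index _ ⟩
      1# + e (unshift i)     ≈⟨ +-congˡ (e-index _) ⟩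
      1# + (e i - 1#)        ≈⟨ solve 1 (λ x → con (+ 1) :+ (x :- con (+ 1)) := x) refl (e i) ⟩
      e i                    ∎)
    unshift∘shift : ∀ i → unshift (shift i) ≡ i
    unshift∘shift i = e-injective (begin
      e (unshift (shift i))  ≈⟨ e-index _ ⟩
      e (shift i) - 1#       ≈⟨ +-congʳ (e-index _) ⟩
      (1# + e i) - 1#        ≈⟨ solve 1 (λ x → (con (+ 1) :+ x) :- con (+ 1) := x) refl (e i) ⟩
      e i                    ∎)

  x^n≈0⇒x≈0 : ∀ {x} n → x ^ n ≈ 0# → x ≈ 0#
  x^n≈0⇒x≈0         zero    1≈0   = contradiction 1≈0 1≉0
  x^n≈0⇒x≈0 {x} (suc n) x^[1+n]≈0 with x ≟ 0#
  ... | yes x≈0 = x≈0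
  ... | no  x≉0 = x^n≈0⇒x≈0 n (x≉0⇒x*y≈0⇒y≈0 x≉0 x^[1+n]≈0)

  characteristic : ∀ {p m} → N ≡ p ^ℕ m → p × 1# ≈ 0#
  characteristic {p} {m} ≡.refl = x^n≈0⇒x≈0 m (begin
    (p × 1#) ^ m      ≈⟨ ×1-homo-^ m ⟨
    (p ^ℕ m) × 1#     ≈⟨ N×1≈0 ⟩
    0#                ∎)
    where
    ×1-homo-^ : ∀ k → (p ^ℕ k) × 1# ≈ (p × 1#) ^ k
    ×1-homo-^ zero    = +-identityʳ 1#
    ×1-homo-^ (suc k) = trans (×1-homo-* p (p ^ℕ k)) (*-congˡ (×1-homo-^ k))

  module _ {p} (p-prime : Prime p) (char : p × 1# ≈ 0#) where

    frobenius-injective : ∀ {x y} → x ^ p ≈ y ^ p → x ≈ y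
    frobenius-injective {x} {y} x^p≈y^p = x∙y⁻¹≈ε⇒x≈y x y (x^n≈0⇒x≈0 p (begin
      (x - y) ^ p          ≈⟨ freshman p-prime char x (- y) ⟩
      x ^ p + (- y) ^ p    ≈⟨ +-cong x^p≈y^p (-x^p≈-[x^p] p-prime char y) ⟩
      y ^ p - y ^ p        ≈⟨ -‿inverseʳ _ ⟩
      0#                   ∎))

    frobenius : Automorphism
    frobenius = record
      { σ      = _^ p
      ; σ-cong = ^-congˡ p
      ; σ-+    = freshman p-prime char
      ; σ-*    = λ x y → ^-distrib-* x y p
      ; σ-1    = 1^n≈1 p
      ; σ-inj  = frobenius-injective
      ; σ-surj = injective⇒surjective (_^ p) frobenius-injective
      }

module ΓLEquivalence {c ℓ} (F : Field c ℓ) where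
  open import Data.Product using (_×_)
  open import Function using (_∘_)
  open Field F
  open FieldTheory F
  open IntegerCoefficientSolver commRing using (solve; _:=_; _:+_; _:*_; _:-_; con)
  open import Relation.Binary.Reasoning.Setoid setoid

  identityAutomorphism : Automorphism
  identityAutomorphism = record
    { σ = λ x → x ; σ-cong = λ x≈y → x≈y ; σ-+ = λ _ _ → refl ; σ-* = λ _ _ → refl
    ; σ-1 = refl ; σ-inj = λ x≈y → x≈y ; σ-surj = λ y → y , refl }

  fPoly-cong : ∀ q t {x y} → x ≈ y → fPoly q t x ≈ fPoly q t y
  fPoly-cong q t x≈y = +-cong (+-cong (^-cong q x≈y) (^-cong (q ^ℕ 3) x≈y)) (*-congˡ (^-cong (q ^ℕ 5) x≈y))
    where
    ^-cong : ∀ {x y} n → x ≈ y → x ^ n ≈ y ^ n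
    ^-cong zero    _   = refl
    ^-cong (suc n) x≈y = *-cong x≈y (^-cong n x≈y)

  module _ (φ : Automorphism) where
    open Automorphism φ

    σ-^ : ∀ x n → σ (x ^ n) ≈ σ x ^ n
    σ-^ x zero    = σ-1
    σ-^ x (suc n) = trans (σ-* x (x ^ n)) (*-congˡ (σ-^ x n))

    σ-fPoly : ∀ q {θ δ} → σ θ ≈ δ → ∀ x → σ (fPoly q θ x) ≈ fPoly q δ (σ x)
    σ-fPoly q {θ} {δ} σθ≈δ x = begin
      σ (x ^ q + x ^ (q ^ℕ 3) + θ * x ^ (q ^ℕ 5))
        ≈⟨ trans (σ-+ _ _) (+-cong (σ-+ _ _) (σ-* _ _)) ⟩
      σ (x ^ q) + σ (x ^ (q ^ℕ 3)) + σ θ * σ (x ^ (q ^ℕ 5))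
        ≈⟨ +-cong (+-cong (σ-^ x q) (σ-^ x (q ^ℕ 3))) (*-cong σθ≈δ (σ-^ x (q ^ℕ 5))) ⟩
      fPoly q δ (σ x) ∎

    automorphism⇒ΓL-Equivalent : ∀ q {θ δ} → σ θ ≈ δ → ΓL-Equivalent (fPoly q θ) (fPoly q δ)
    automorphism⇒ΓL-Equivalent q {θ} {δ} σθ≈δ = φ̂ , image⊆graph , graph⊆image
      where
      1*u+0*v≈u : ∀ u v → 1# * u + 0# * v ≈ u
      1*u+0*v≈u = solve 2 (λ u v → con (+ 1) :* u :+ con (+ 0) :* v := u) refl
      0*u+1*v≈v : ∀ u v → 0# * u + 1# * v ≈ v
      0*u+1*v≈v = solve 2 (λ u v → con (+ 0) :* u :+ con (+ 1) :* v := v) refl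
      det≈1 : 1# * 1# - 0# * 0# ≈ 1#
      det≈1 = solve 0 (con (+ 1) :* con (+ 1) :- con (+ 0) :* con (+ 0) := con (+ 1)) refl
      φ̂ : ΓL2
      φ̂ = record { aut = φ ; a = 1# ; b = 0# ; c = 0# ; d = 1# ; det≉0 = 1≉0 ∘ trans (sym det≈1) }
      open ΓL2 φ̂ using (apply₁; apply₂)
      image⊆graph : ∀ x → Σ Carrier λ y →
                    apply₁ x (fPoly q θ x) ≈ y × apply₂ x (fPoly q θ x) ≈ fPoly q δ y
      image⊆graph x = σ x , 1*u+0*v≈u _ _ , trans (0*u+1*v≈v _ _) (σ-fPoly q σθ≈δ x)
      graph⊆image : ∀ y → Σ Carrier λ x →
                    apply₁ x (fPoly q θ x) ≈ y × apply₂ x (fPoly q θ x) ≈ fPoly q δ y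
      graph⊆image y with σ-surj y
      ... | x , σx≈y = x , trans (1*u+0*v≈u _ _) σx≈y ,
                       trans (0*u+1*v≈v _ _) (trans (σ-fPoly q σθ≈δ x) (fPoly-cong q δ σx≈y))

lemma3p2 : {c ℓ : Level} (q : ℕ) → IsPrimePower q → q % 2 ≡ 1 → (q % 5 ≡ 2 ⊎ q % 5 ≡ 3)
    → (F : Field c ℓ) → FieldTheory.HasSize F (q ^ℕ 6)
    → (θ δ : Field.Carrier F)
    → Field._≈_ F (Field._+_ F (Field._*_ F θ θ) θ) (Field.1# F)
    → Field._≈_ F (Field._+_ F (Field._*_ F δ δ) δ) (Field.1# F)
    → FieldTheory.ΓL-Equivalent F (FieldTheory.fPoly F q θ) (FieldTheory.fPoly F q δ)
lemma3p2 q (p , k , p-prime , _ , q≡pᵏ) _ q%5≡2∨3 F size θ δ θ-golden δ-golden with θ ≟ δ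
  where open FiniteField F size using (_≟_)
... | yes θ≈δ = automorphism⇒ΓL-Equivalent identityAutomorphism q θ≈δ
  where open ΓLEquivalence F
... | no θ≉δ = automorphism⇒ΓL-Equivalent (frobenius p-prime char) q
                 (golden^p≈conjugate p-prime char p%5≡2∨3 θ-golden δ-golden θ≉δ)
  where
  open Field F
  open ΓLEquivalence F
  open FiniteField F size
  open FieldProperties F using (golden^p≈conjugate)
  open import Algebra.Properties.Semiring.Mult semiring using (_×_)
  char : p × 1# ≈ 0#
  char = characteristic {p} {k ℕ.* 6} (≡.trans (≡.cong (_^ℕ 6) q≡pᵏ) (ℕ.^-*-assoc p k 6))
  p%5≡2∨3 : p % 5 ≡ 2 ⊎ p % 5 ≡ 3
  p%5≡2∨3 = ^-%5≡2∨3⇒%5≡2∨3 p k (≡.subst (λ n → n % 5 ≡ 2 ⊎ n % 5 ≡ 3) q≡pᵏ q%5≡2∨3)
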